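{- Let $\lambda=(m,n)$ be a triangular $2$-partition with top-down tableau $\theta$, and let $\mu=(m-i,n-j)$ be a subpartition of $\lambda$. If $\mu$ is in the center or on the right side (i.e. $i\ge j$), then $\mathrm{sim}_\theta(\mu)=m-i+\max(0,n-i)$. If $\mu$ is on the left side (i.e. $i<j$), then $\mathrm{sim}_\theta(\mu)=m+n-2j+1$.
   Context: Partitions are drawn in French convention: cell $(\ell,c)$ ($\ell\ge0$ row from bottom, $c\ge0$ column). A $2$-partition $(m,n)$ has $m\ge n\ge0$; it is triangular if there exist positive reals $r,s$ with $\lambda_j=\lfloor r-jr/s\rfloor$ for $1\le j\le s$ and $\lambda_j=0$ for $j>s$. The top-down tableau of a partition of size $N$ labels with $N$ the last cell of the top row, $N-1$ the last cell of the row below, etc., one cell per nonempty row down to the bottom, then repeats on the remaining cells with the next smaller labels. For a standard tableau $\theta$ and subpartition $\mu$, a cell $d$ is a $\theta$-deficit cell if there exist $c_1=(i_1,j_1)\in\mu$, $c_2=(i_2,j_2)\in\lambda\setminus\mu$ with $\theta(c_1)>\theta(c_2)$ and $d=(\min(i_1,i_2),\min(j_1,j_2))$; $\mathrm{sim}_\theta(\mu)$ is the number of cells of $\mu$ that are not $\theta$-deficit cells. A subpartition $(m-i,n-j)$ is on the left side if $i<j$, in the center if $i=j$, on the right side if $i>j$.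
   Formalization: The positive reals r, s in the definition of a triangular 2-partition range over the positive rationals. -}

module Defs where

open import Data.Bool.Base using (Bool; true; false; if_then_else_; not; _∧_)
open import Data.Nat.Base as ℕ using (ℕ; zero; suc; _+_; _∸_; _⊓_; _≤_; _<_; _≡ᵇ_; _<ᵇ_)
open import Data.Integer.Base as ℤ using (ℤ; +_)
open import Data.Rational.Base as ℚ using (ℚ; Positive; floor)
open import Data.Rational.Properties using (pos⇒nonZero)
open import Data.Bool.ListAction using (any)
open import Data.List.Base using (List; []; _∷_; upTo; map; _++_; filterᵇ; length; cartesianProduct)
open import Data.Product.Base using (Σ; _×_; _,_)
open import Relation.Binary.PropositionalEquality using (_≡_)

-- 2-partitions (m , n) with m ≥ n ≥ 0; parts are indexed from 1:
-- λ₁ = m, λ₂ = n, λⱼ = 0 for j ≥ 3.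

part : ℕ → ℕ → ℕ → ℕ
part m n 1 = m
part m n 2 = n
part m n _ = 0

ℕ→ℚ : ℕ → ℚ
ℕ→ℚ j = (+ j) ℚ./ 1

triVal : (r s : ℚ) → Positive s → ℕ → ℚ
triVal r s ps j = r ℚ.- ℚ._÷_ (ℕ→ℚ j ℚ.* r) s {{pos⇒nonZero s {{ps}}}}

-- λ is triangular: there are positive r , s with λⱼ = ⌊ r - j r / s ⌋ for
-- 1 ≤ j ≤ s and λⱼ = 0 for j > s.  (Reals replaced by rationals.)
Triangular : ℕ → ℕ → Set
Triangular m n =
  Σ ℚ λ r → Σ ℚ λ s → Σ (Positive r) λ _ → Σ (Positive s) λ ps →
    (j : ℕ) → 1 ≤ j →
      (ℕ→ℚ j ℚ.≤ s → floor (triVal r s ps j) ≡ + part m n j)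
    × (s ℚ.< ℕ→ℚ j → part m n j ≡ 0)

-- Cells (ℓ , c): ℓ = row from the bottom, c = column (French convention).

Cell : Set
Cell = ℕ × ℕ

cells : ℕ → ℕ → List Cell
cells m n = map (λ c → (0 , c)) (upTo m) ++ map (λ c → (1 , c)) (upTo n)

inShapeᵇ : ℕ → ℕ → Cell → Bool
inShapeᵇ m n (0 , c) = c <ᵇ m
inShapeᵇ m n (1 , c) = c <ᵇ n
inShapeᵇ m n (suc (suc _) , c) = false

-- Top-down tableau of (m , n) (m ≥ n): label m+n goes to the last cell of
-- the top row, m+n-1 to the last cell of the row below, ..., one cell per
-- nonempty row; then repeat on the remaining shape with smaller labels.
-- For n > 0 the remaining shape is (m-1 , n-1); for n = 0 it is (m-1 , 0).
-- topDown m n (ℓ , c) is the label of cell (ℓ , c) (0 outside the shape).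
topDown : ℕ → ℕ → Cell → ℕ
topDown (suc m) zero (0 , c) =
  if c ≡ᵇ m then suc m else topDown m zero (0 , c)
topDown (suc m) (suc n) (1 , c) =
  if c ≡ᵇ n then suc m + suc n else topDown m n (1 , c)
topDown (suc m) (suc n) (0 , c) =
  if c ≡ᵇ m then m + suc n else topDown m n (0 , c)
topDown _ _ _ = 0

_≡ᶜ_ : Cell → Cell → Bool
(a , b) ≡ᶜ (c , d) = (a ≡ᵇ c) ∧ (b ≡ᵇ d)

isDeficitᵇ : (θ : Cell → ℕ) (m n m' n' : ℕ) → Cell → Bool
isDeficitᵇ θ m n m' n' d =
  any (λ { ((i₁ , j₁) , (i₂ , j₂)) →
           (θ (i₂ , j₂) <ᵇ θ (i₁ , j₁)) ∧ (d ≡ᶜ (i₁ ℕ.⊓ i₂ , j₁ ℕ.⊓ j₂)) })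
      (cartesianProduct (cells m' n')
                        (filterᵇ (λ x → not (inShapeᵇ m' n' x)) (cells m n)))

sim : (θ : Cell → ℕ) (m n m' n' : ℕ) → ℕ
sim θ m n m' n' = length (filterᵇ (λ d → not (isDeficitᵇ θ m n m' n' d)) (cells m' n'))

{-# OPTIONS --safe #-}
module Submission where

-- Write λ = (n + d , n).  Its top-down tableau labels the bottom-row cell c with
-- (c + 1) + (c ∸ d) and the top-row cell c with (c + d + 1) + (c + 1), so the label of (1 , y)
-- lies strictly between those of (0 , y + d) and (0 , y + d + 1).  Labels increase along rows,
-- so an inverted pair for μ = (a , b) never lies in one row: no top-row cell is a deficit cell,
-- and the deficit cells are the bottom-row cells (0 , c) with either a ∸ d ≤ c < b, where
-- (1 , c) ∈ μ outranks (0 , a) ∉ μ, or b ≤ c and c + d + 1 < a, where (0 , c + d + 1) ∈ μ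
-- outranks (1 , c) ∉ μ.  Only the first interval can be nonempty when μ is in the center or on
-- the right, only the second when μ is on the left; counting the remaining cells gives the
-- two formulas.

open import Defs
open import Data.Bool.Base using (Bool; true; false; if_then_else_; not; T)
open import Data.Bool.Properties using (T-≡; T-∧)
open import Data.Empty using (⊥-elim)
open import Data.List.Base using (List; _∷_; _++_; map; upTo; applyUpTo; filterᵇ; length; cartesianProduct)
open import Data.List.Properties using (filter-++; length-++; filter-all; filter-none; length-applyUpTo; map-upTo)
open import Data.List.Relation.Unary.All.Properties using (applyUpTo⁺₁)
open import Data.List.Relation.Unary.Any.Properties using (any⁺; any⁻)
open import Data.List.Membership.Propositional using (_∈_; find; lose)
open import Data.List.Membership.Propositional.Properties
  using (∈-++⁻; ∈-++⁺ˡ; ∈-++⁺ʳ; ∈-map⁻; ∈-map⁺; ∈-upTo⁻; ∈-upTo⁺; ∈-filter⁻; ∈-filter⁺; ∈-cartesianProduct⁻; ∈-cartesianProduct⁺)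
open import Data.Nat.Base using (ℕ; zero; suc; _+_; _*_; _∸_; _⊔_; _⊓_; _≤_; _<_; _≡ᵇ_; s≤s; s≤s⁻¹)
open import Data.Nat.Properties
open import Data.Nat.Tactic.RingSolver using (solve-∀)
open import Data.Product.Base using (_×_; _,_; proj₁; proj₂)
open import Data.Product.Properties using (×-≡,≡→≡; ×-≡,≡←≡)
open import Data.Sum.Base using (_⊎_; inj₁; inj₂; [_,_])
open import Data.Unit.Base using (tt)
open import Function.Base using (_∘_; id)
open import Function.Bundles using (_⇔_; mk⇔; Equivalence)
open import Function.Construct.Composition using (_⇔-∘_)
open import Relation.Binary.PropositionalEquality
  using (_≡_; _≢_; refl; sym; trans; cong; cong₂; subst; subst₂; module ≡-Reasoning)
open import Relation.Nullary using (¬_)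
open import Relation.Nullary.Decidable using (T?)

open Equivalence using (to; from)

applyUpTo-+ : ∀ {A : Set} (f : ℕ → A) m n →
  applyUpTo f (m + n) ≡ applyUpTo f m ++ applyUpTo (f ∘ (m +_)) n
applyUpTo-+ f zero    n = refl
applyUpTo-+ f (suc m) n = cong (f 0 ∷_) (applyUpTo-+ (f ∘ suc) m n)

T-not⇔¬T : ∀ {x} → T (not x) ⇔ (¬ T x)
T-not⇔¬T {false} = mk⇔ (λ _ ()) (λ _ → tt)
T-not⇔¬T {true}  = mk⇔ (λ ()) (λ ¬t → ¬t tt)

length-filterᵇ-++ : ∀ {A : Set} (p : A → Bool) (xs ys : List A) →
  length (filterᵇ p (xs ++ ys)) ≡ length (filterᵇ p xs) + length (filterᵇ p ys)
length-filterᵇ-++ p xs ys =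
  trans (cong length (filter-++ (T? ∘ p) xs ys)) (length-++ (filterᵇ p xs))

module _ {A : Set} (p : A → Bool) where

  length-filterᵇ-applyUpTo-all : ∀ (f : ℕ → A) k → (∀ {c} → c < k → T (p (f c))) →
    length (filterᵇ p (applyUpTo f k)) ≡ k
  length-filterᵇ-applyUpTo-all f k all =
    trans (cong length (filter-all (T? ∘ p) (applyUpTo⁺₁ f k all))) (length-applyUpTo f k)

  length-filterᵇ-applyUpTo-none : ∀ (f : ℕ → A) k → (∀ {c} → c < k → ¬ T (p (f c))) →
    length (filterᵇ p (applyUpTo f k)) ≡ 0
  length-filterᵇ-applyUpTo-none f k none =
    cong length (filter-none (T? ∘ p) (applyUpTo⁺₁ f k none))

length-filterᵇ-applyUpTo-+ : ∀ {A : Set} (p : A → Bool) (f : ℕ → A) m n →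
  length (filterᵇ p (applyUpTo f (m + n)))
    ≡ length (filterᵇ p (applyUpTo f m)) + length (filterᵇ p (applyUpTo (f ∘ (m +_)) n))
length-filterᵇ-applyUpTo-+ p f m n =
  trans (cong (length ∘ filterᵇ p) (applyUpTo-+ f m n))
        (length-filterᵇ-++ p (applyUpTo f m) (applyUpTo (f ∘ (m +_)) n))

length-filterᵇ-applyUpTo-gap : ∀ {A : Set} (q : A → Bool) (f : ℕ → A) {lo hi a} →
  lo ≤ hi → hi ≤ a → (∀ {c} → c < a → T (q (f c)) ⇔ (lo ≤ c × c < hi)) →
  length (filterᵇ (not ∘ q) (applyUpTo f a)) ≡ lo + (a ∸ hi)
length-filterᵇ-applyUpTo-gap q f {lo} lo≤hi hi≤a q⇔
  with k , refl ← m≤n⇒∃[o]m+o≡n lo≤hi | r , refl ← m≤n⇒∃[o]m+o≡n hi≤a = begin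
    length (filterᵇ p (applyUpTo f (lo + k + r)))
      ≡⟨ length-filterᵇ-applyUpTo-+ p f (lo + k) r ⟩
    length (filterᵇ p (applyUpTo f (lo + k))) + length (filterᵇ p right)
      ≡⟨ cong (_+ length (filterᵇ p right)) (length-filterᵇ-applyUpTo-+ p f lo k) ⟩
    length (filterᵇ p left) + length (filterᵇ p middle) + length (filterᵇ p right)
      ≡⟨ cong₂ _+_ (cong₂ _+_ left-kept middle-removed) right-kept ⟩
    lo + 0 + r
      ≡⟨ cong (_+ r) (+-identityʳ lo) ⟩
    lo + r
      ≡⟨ cong (lo +_) (m+n∸m≡n (lo + k) r) ⟨
    lo + (lo + k + r ∸ (lo + k)) ∎
  where
  open ≡-Reasoning
  p = not ∘ q
  left = applyUpTo f lo
  middle = applyUpTo (f ∘ (lo +_)) k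
  right = applyUpTo (f ∘ (lo + k +_)) r

  lo+k≤a : lo + k ≤ lo + k + r
  lo+k≤a = m≤m+n (lo + k) r

  left-kept : length (filterᵇ p left) ≡ lo
  left-kept = length-filterᵇ-applyUpTo-all p f lo λ {c} c<lo →
    let c<a = <-≤-trans c<lo (≤-trans (m≤m+n lo k) lo+k≤a) in
    from T-not⇔¬T (λ qc → <⇒≱ c<lo (proj₁ (to (q⇔ c<a) qc)))

  middle-removed : length (filterᵇ p middle) ≡ 0
  middle-removed = length-filterᵇ-applyUpTo-none p (f ∘ (lo +_)) k λ {c} c<k →
    let lo+c<a = <-≤-trans (+-monoʳ-< lo c<k) lo+k≤a in
    λ pc → to T-not⇔¬T pc (from (q⇔ lo+c<a) (m≤m+n lo c , +-monoʳ-< lo c<k))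

  right-kept : length (filterᵇ p right) ≡ r
  right-kept = length-filterᵇ-applyUpTo-all p (f ∘ (lo + k +_)) r λ {c} c<r →
    from T-not⇔¬T (λ qc → <⇒≱ (proj₂ (to (q⇔ (+-monoʳ-< (lo + k) c<r)) qc)) (m≤m+n (lo + k) c))

data InShape (m n : ℕ) : Cell → Set where
  row₀ : ∀ {c} → c < m → InShape m n (0 , c)
  row₁ : ∀ {c} → c < n → InShape m n (1 , c)

InShape-mono : ∀ {m n m' n' x} → m' ≤ m → n' ≤ n → InShape m' n' x → InShape m n x
InShape-mono m'≤m _ (row₀ c<m') = row₀ (<-≤-trans c<m' m'≤m)
InShape-mono _ n'≤n (row₁ c<n') = row₁ (<-≤-trans c<n' n'≤n)

∈-cells⇔ : ∀ {m n x} → x ∈ cells m n ⇔ InShape m n x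
∈-cells⇔ {m} {n} = mk⇔ to′ from′
  where
  to′ : ∀ {x} → x ∈ cells m n → InShape m n x
  to′ x∈ with ∈-++⁻ (map (λ c → (0 , c)) (upTo m)) x∈
  ... | inj₁ x∈row₀ with c , c∈ , refl ← ∈-map⁻ _ x∈row₀ = row₀ (∈-upTo⁻ c∈)
  ... | inj₂ x∈row₁ with c , c∈ , refl ← ∈-map⁻ _ x∈row₁ = row₁ (∈-upTo⁻ c∈)

  from′ : ∀ {x} → InShape m n x → x ∈ cells m n
  from′ (row₀ c<m) = ∈-++⁺ˡ (∈-map⁺ _ (∈-upTo⁺ c<m))
  from′ (row₁ c<n) = ∈-++⁺ʳ (map (λ c → (0 , c)) (upTo m)) (∈-map⁺ _ (∈-upTo⁺ c<n))

T-inShapeᵇ⇔ : ∀ {m n x} → T (inShapeᵇ m n x) ⇔ InShape m n x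
T-inShapeᵇ⇔ {m} {n} {x} = mk⇔ (to′ x) from′
  where
  to′ : ∀ x → T (inShapeᵇ m n x) → InShape m n x
  to′ (0 , c) t = row₀ (<ᵇ⇒< c m t)
  to′ (1 , c) t = row₁ (<ᵇ⇒< c n t)

  from′ : ∀ {x} → InShape m n x → T (inShapeᵇ m n x)
  from′ (row₀ c<m) = <⇒<ᵇ c<m
  from′ (row₁ c<n) = <⇒<ᵇ c<n

∈-outside⇔ : ∀ {m n m' n' x} →
  x ∈ filterᵇ (λ y → not (inShapeᵇ m' n' y)) (cells m n) ⇔ (InShape m n x × ¬ InShape m' n' x)
∈-outside⇔ {m} {n} {m'} {n'} = mk⇔
  (λ x∈ → let x∈λ , x∉μ = ∈-filter⁻ (T? ∘ outside) x∈ in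
          to ∈-cells⇔ x∈λ , to T-not⇔¬T x∉μ ∘ from T-inShapeᵇ⇔)
  (λ (x∈λ , x∉μ) → ∈-filter⁺ (T? ∘ outside) (from ∈-cells⇔ x∈λ)
                     (from T-not⇔¬T (x∉μ ∘ to T-inShapeᵇ⇔)))
  where
  outside : Cell → Bool
  outside y = not (inShapeᵇ m' n' y)

T-≡ᶜ⇔ : ∀ {x y} → T (x ≡ᶜ y) ⇔ (x ≡ y)
T-≡ᶜ⇔ {i , j} {k , l} = mk⇔
  (λ t → let i≡k , j≡l = to T-∧ t in ×-≡,≡→≡ (≡ᵇ⇒≡ i k i≡k , ≡ᵇ⇒≡ j l j≡l))
  (λ x≡y → let i≡k , j≡l = ×-≡,≡←≡ x≡y in from T-∧ (≡⇒≡ᵇ i k i≡k , ≡⇒≡ᵇ j l j≡l))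

meet : Cell → Cell → Cell
meet (i₁ , j₁) (i₂ , j₂) = (i₁ ⊓ i₂ , j₁ ⊓ j₂)

data IsDeficit (θ : Cell → ℕ) (m n m' n' : ℕ) (d : Cell) : Set where
  deficit : ∀ {c₁ c₂} → InShape m' n' c₁ → InShape m n c₂ → ¬ InShape m' n' c₂ →
            θ c₂ < θ c₁ → d ≡ meet c₁ c₂ → IsDeficit θ m n m' n' d

T-isDeficitᵇ⇔ : ∀ {θ m n m' n' d} → T (isDeficitᵇ θ m n m' n' d) ⇔ IsDeficit θ m n m' n' d
T-isDeficitᵇ⇔ {θ} {m} {n} {m'} {n'} {d} = mk⇔ to′ from′
  where
  outer = filterᵇ (λ y → not (inShapeᵇ m' n' y)) (cells m n)

  to′ : T (isDeficitᵇ θ m n m' n' d) → IsDeficit θ m n m' n' d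
  to′ t
    with (c₁ , c₂) , c₁c₂∈ , holds ← find (any⁻ _ (cartesianProduct (cells m' n') outer) t)
    with c₁∈μ , c₂∈ ← ∈-cartesianProduct⁻ (cells m' n') outer c₁c₂∈
    with c₂∈λ , c₂∉μ ← to ∈-outside⇔ c₂∈
    with inverted , d≡meet ← to T-∧ holds
    = deficit (to ∈-cells⇔ c₁∈μ) c₂∈λ c₂∉μ (<ᵇ⇒< _ _ inverted) (to T-≡ᶜ⇔ d≡meet)

  from′ : IsDeficit θ m n m' n' d → T (isDeficitᵇ θ m n m' n' d)
  from′ (deficit c₁∈μ c₂∈λ c₂∉μ inverted d≡meet) = any⁺ _ (lose
    (∈-cartesianProduct⁺ (from ∈-cells⇔ c₁∈μ) (from ∈-outside⇔ (c₂∈λ , c₂∉μ)))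
    (from T-∧ (<⇒<ᵇ inverted , from T-≡ᶜ⇔ d≡meet)))

m∸n≤o⇒m≤o+n : ∀ {m n o} → m ∸ n ≤ o → m ≤ o + n
m∸n≤o⇒m≤o+n {m} {n} {o} m∸n≤o =
  ≤-trans (m≤n+m∸n m n) (≤-trans (+-monoʳ-≤ n m∸n≤o) (≤-reflexive (+-comm n o)))

label : ℕ → Cell → ℕ
label d (0 , c) = suc c + (c ∸ d)
label d (1 , c) = suc (c + d) + suc c
label d _       = 0

≡ᵇ-if-elim : ∀ {A : Set} (P : A → Set) {x y : A} c k →
  (c ≡ k → P x) → (c ≢ k → P y) → P (if c ≡ᵇ k then x else y)
≡ᵇ-if-elim P c k on-≡ on-≢ with c ≡ᵇ k in eq
... | true  = on-≡ (≡ᵇ⇒≡ c k (from T-≡ eq))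
... | false = on-≢ (λ c≡k → subst T eq (≡⇒≡ᵇ c k c≡k))

topDown-one-row : ∀ m c → c < m → topDown m 0 (0 , c) ≡ suc c
topDown-one-row (suc m) c c<1+m = ≡ᵇ-if-elim (_≡ suc c) c m
  (λ c≡m → cong suc (sym c≡m))
  (λ c≢m → topDown-one-row m c (≤∧≢⇒< (s≤s⁻¹ c<1+m) c≢m))

topDown-row₀ : ∀ n d c → c < n + d → topDown (n + d) n (0 , c) ≡ label d (0 , c)
topDown-row₀ zero d c c<d = begin
  topDown d 0 (0 , c)   ≡⟨ topDown-one-row d c c<d ⟩
  suc c                 ≡⟨ +-identityʳ (suc c) ⟨
  suc c + 0             ≡⟨ cong (suc c +_) (m≤n⇒m∸n≡0 (<⇒≤ c<d)) ⟨
  suc c + (c ∸ d)       ∎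
  where open ≡-Reasoning
topDown-row₀ (suc n) d c c<M = ≡ᵇ-if-elim (_≡ label d (0 , c)) c (n + d)
  (λ { refl → trans (+-suc (n + d) n) (cong (suc (n + d) +_) (sym (m+n∸n≡m n d))) })
  (λ c≢n+d → topDown-row₀ n d c (≤∧≢⇒< (s≤s⁻¹ c<M) c≢n+d))

topDown-row₁ : ∀ n d c → c < n → topDown (n + d) n (1 , c) ≡ label d (1 , c)
topDown-row₁ (suc n) d c c<1+n = ≡ᵇ-if-elim (_≡ label d (1 , c)) c n
  (λ { refl → refl })
  (λ c≢n → topDown-row₁ n d c (≤∧≢⇒< (s≤s⁻¹ c<1+n) c≢n))

topDown-label : ∀ {n d x} → InShape (n + d) n x → topDown (n + d) n x ≡ label d x
topDown-label {n} {d} (row₀ c<M) = topDown-row₀ n d _ c<M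
topDown-label {n} {d} (row₁ c<n) = topDown-row₁ n d _ c<n

label-row₀-mono : ∀ d {x y} → x ≤ y → label d (0 , x) ≤ label d (0 , y)
label-row₀-mono d x≤y = +-mono-≤ (s≤s x≤y) (∸-monoˡ-≤ d x≤y)

label-row₁-mono : ∀ d {x y} → x ≤ y → label d (1 , x) ≤ label d (1 , y)
label-row₁-mono d x≤y = +-mono-≤ (s≤s (+-monoˡ-≤ d x≤y)) (s≤s x≤y)

label-row₁≡1+label-row₀ : ∀ d y → label d (1 , y) ≡ suc (label d (0 , y + d))
label-row₁≡1+label-row₀ d y = begin
  suc (y + d) + suc y                ≡⟨ +-suc (suc (y + d)) y ⟩
  suc (suc (y + d) + y)              ≡⟨ cong (λ z → suc (suc (y + d) + z)) (m+n∸n≡m y d) ⟨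
  suc (suc (y + d) + (y + d ∸ d))    ∎
  where open ≡-Reasoning

label-row₀≡1+label-row₁ : ∀ d y → label d (0 , suc y + d) ≡ suc (label d (1 , y))
label-row₀≡1+label-row₁ d y = cong (suc (suc y + d) +_) (m+n∸n≡m (suc y) d)

label-row₁<label-row₀⇔ : ∀ d {x y} → label d (1 , y) < label d (0 , x) ⇔ y + d < x
label-row₁<label-row₀⇔ d {x} {y} = mk⇔
  (λ lt → ≰⇒> λ x≤y+d → <⇒≱ lt (begin
    label d (0 , x)              ≤⟨ label-row₀-mono d x≤y+d ⟩
    label d (0 , y + d)          ≤⟨ n≤1+n _ ⟩
    suc (label d (0 , y + d))    ≡⟨ label-row₁≡1+label-row₀ d y ⟨
    label d (1 , y)              ∎))
  (λ y+d<x → begin-strict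
    label d (1 , y)              <⟨ n<1+n _ ⟩
    suc (label d (1 , y))        ≡⟨ label-row₀≡1+label-row₁ d y ⟨
    label d (0 , suc y + d)      ≤⟨ label-row₀-mono d y+d<x ⟩
    label d (0 , x)              ∎)
  where open ≤-Reasoning

label-row₀<label-row₁⇔ : ∀ d {x y} → label d (0 , y) < label d (1 , x) ⇔ y ∸ d ≤ x
label-row₀<label-row₁⇔ d {x} {y} = mk⇔
  (λ lt → let y≤x+d = ≮⇒≥ (<-asym lt ∘ from (label-row₁<label-row₀⇔ d)) in
    ≤-trans (∸-monoˡ-≤ d y≤x+d) (≤-reflexive (m+n∸n≡m x d)))
  (λ y∸d≤x → begin-strict
    label d (0 , y)              ≤⟨ label-row₀-mono d (m∸n≤o⇒m≤o+n y∸d≤x) ⟩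
    label d (0 , x + d)          <⟨ n<1+n _ ⟩
    suc (label d (0 , x + d))    ≡⟨ label-row₁≡1+label-row₀ d x ⟨
    label d (1 , x)              ∎)
  where open ≤-Reasoning

module TopDownDeficits (n d a b : ℕ) (b≤a : b ≤ a) (a≤n+d : a ≤ n + d) (b≤n : b ≤ n) where

  θ : Cell → ℕ
  θ = topDown (n + d) n

  Deficit : Cell → Set
  Deficit = IsDeficit θ (n + d) n a b

  inverted-labels : ∀ {c₁ c₂} → InShape a b c₁ → InShape (n + d) n c₂ →
    θ c₂ < θ c₁ → label d c₂ < label d c₁
  inverted-labels c₁∈μ c₂∈λ =
    subst₂ _<_ (topDown-label c₂∈λ) (topDown-label (InShape-mono a≤n+d b≤n c₁∈μ))

  inverted-topDown : ∀ {c₁ c₂} → InShape (n + d) n c₁ → InShape (n + d) n c₂ →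
    label d c₂ < label d c₁ → θ c₂ < θ c₁
  inverted-topDown c₁∈λ c₂∈λ =
    subst₂ _<_ (sym (topDown-label c₂∈λ)) (sym (topDown-label c₁∈λ))

  outside-row₀ : ∀ {y} → ¬ InShape a b (0 , y) → a ≤ y
  outside-row₀ y∉μ = ≮⇒≥ (y∉μ ∘ row₀)

  outside-row₁ : ∀ {y} → ¬ InShape a b (1 , y) → b ≤ y
  outside-row₁ y∉μ = ≮⇒≥ (y∉μ ∘ row₁)

  no-inversion-row₀ : ∀ {x y} → InShape a b (0 , x) → InShape (n + d) n (0 , y) →
    ¬ InShape a b (0 , y) → ¬ θ (0 , y) < θ (0 , x)
  no-inversion-row₀ x∈μ@(row₀ x<a) y∈λ y∉μ inv = <⇒≱ (inverted-labels x∈μ y∈λ inv)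
    (label-row₀-mono d (≤-trans (<⇒≤ x<a) (outside-row₀ y∉μ)))

  no-inversion-row₁ : ∀ {x y} → InShape a b (1 , x) → InShape (n + d) n (1 , y) →
    ¬ InShape a b (1 , y) → ¬ θ (1 , y) < θ (1 , x)
  no-inversion-row₁ x∈μ@(row₁ x<b) y∈λ y∉μ inv = <⇒≱ (inverted-labels x∈μ y∈λ inv)
    (label-row₁-mono d (≤-trans (<⇒≤ x<b) (outside-row₁ y∉μ)))

  no-deficit-row₁ : ∀ {c} → ¬ Deficit (1 , c)
  no-deficit-row₁ (deficit x∈μ@(row₁ _) y∈λ@(row₁ _) y∉μ inv _) = no-inversion-row₁ x∈μ y∈λ y∉μ inv
  no-deficit-row₁ (deficit (row₀ _) (row₀ _) _ _ ())
  no-deficit-row₁ (deficit (row₀ _) (row₁ _) _ _ ())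
  no-deficit-row₁ (deficit (row₁ _) (row₀ _) _ _ ())

  deficit-row₀⇔ : ∀ {c} → Deficit (0 , c) ⇔ ((a ∸ d ≤ c × c < b) ⊎ (b ≤ c × suc c + d < a))
  deficit-row₀⇔ {c} = mk⇔ sound complete
    where
    sound : Deficit (0 , c) → (a ∸ d ≤ c × c < b) ⊎ (b ≤ c × suc c + d < a)
    sound (deficit x∈μ@(row₀ _) y∈λ@(row₀ _) y∉μ inv _) = ⊥-elim (no-inversion-row₀ x∈μ y∈λ y∉μ inv)
    sound (deficit x∈μ@(row₁ _) y∈λ@(row₁ _) y∉μ inv _) = ⊥-elim (no-inversion-row₁ x∈μ y∈λ y∉μ inv)
    sound (deficit {0 , x} {1 , y} x∈μ@(row₀ x<a) y∈λ@(row₁ _) y∉μ inv refl) =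
      inj₂ (subst (λ z → b ≤ z × suc z + d < a) (sym (m≥n⇒m⊓n≡n y≤x))
                  (outside-row₁ y∉μ , ≤-<-trans y+d<x x<a))
      where
      y+d<x = to (label-row₁<label-row₀⇔ d) (inverted-labels x∈μ y∈λ inv)
      y≤x = ≤-trans (m≤m+n y d) (<⇒≤ y+d<x)
    sound (deficit {1 , x} {0 , y} x∈μ@(row₁ x<b) y∈λ@(row₀ _) y∉μ inv refl) =
      inj₁ (subst (λ z → a ∸ d ≤ z × z < b) (sym (m≤n⇒m⊓n≡m x≤y)) (a∸d≤x , x<b))
      where
      x≤y = ≤-trans (<⇒≤ x<b) (≤-trans b≤a (outside-row₀ y∉μ))
      a∸d≤x = ≤-trans (∸-monoˡ-≤ d (outside-row₀ y∉μ))
                      (to (label-row₀<label-row₁⇔ d) (inverted-labels x∈μ y∈λ inv))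

    complete : (a ∸ d ≤ c × c < b) ⊎ (b ≤ c × suc c + d < a) → Deficit (0 , c)
    complete (inj₁ (a∸d≤c , c<b)) =
      deficit (row₁ c<b) (row₀ a<n+d) (λ { (row₀ a<a) → <-irrefl refl a<a })
        (inverted-topDown (row₁ c<n) (row₀ a<n+d) (from (label-row₀<label-row₁⇔ d) a∸d≤c))
        (cong (0 ,_) (sym (m≤n⇒m⊓n≡m (≤-trans (<⇒≤ c<b) b≤a))))
      where
      c<n = <-≤-trans c<b b≤n
      a<n+d = ≤-<-trans (m∸n≤o⇒m≤o+n a∸d≤c) (+-monoˡ-< d c<n)
    complete (inj₂ (b≤c , 1+c+d<a)) =
      deficit (row₀ 1+c+d<a) (row₁ c<n) (λ { (row₁ c<b) → <⇒≱ c<b b≤c })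
        (inverted-topDown (row₀ (<-≤-trans 1+c+d<a a≤n+d)) (row₁ c<n)
                          (from (label-row₁<label-row₀⇔ d) ≤-refl))
        (cong (0 ,_) (sym (m≥n⇒m⊓n≡n (≤-trans (m≤m+n c d) (n≤1+n (c + d))))))
      where
      c<n = +-cancelʳ-< d c n (<-≤-trans (<-trans (n<1+n (c + d)) 1+c+d<a) a≤n+d)

  deficit-row₀⇔-right : a ≤ b + d → ∀ {c} → Deficit (0 , c) ⇔ (a ∸ d ≤ c × c < b)
  deficit-row₀⇔-right a≤b+d = mk⇔
    (λ D → [ id , (λ (b≤c , 1+c+d<a) → ⊥-elim (<⇒≱ (<-≤-trans 1+c+d<a a≤b+d)
                     (≤-trans (+-monoˡ-≤ d b≤c) (n≤1+n _)))) ] (to deficit-row₀⇔ D))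
    (from deficit-row₀⇔ ∘ inj₁)

  deficit-row₀⇔-left : b + d < a → ∀ {c} → Deficit (0 , c) ⇔ (b ≤ c × c < a ∸ suc d)
  deficit-row₀⇔-left b+d<a {c} = mk⇔
    (λ D → [ (λ (a∸d≤c , c<b) → ⊥-elim (<⇒≱ b+d<a
                 (≤-trans (m∸n≤o⇒m≤o+n a∸d≤c) (+-monoˡ-≤ d (<⇒≤ c<b)))))
           , (λ (b≤c , 1+c+d<a) →
                b≤c , m+n≤o⇒m≤o∸n (suc c) (≤-trans (≤-reflexive (+-suc (suc c) d)) 1+c+d<a))
           ] (to deficit-row₀⇔ D))
    (λ (b≤c , c<a∸1+d) → from deficit-row₀⇔ (inj₂ (b≤c ,
       ≤-trans (≤-reflexive (sym (+-suc (suc c) d))) (m≤o∸n⇒m+n≤o (suc c) 1+d≤a c<a∸1+d))))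
    where
    1+d≤a = ≤-<-trans (m≤n+m d b) b+d<a

  sim-topDown : ∀ {lo hi} → lo ≤ hi → hi ≤ a → (∀ {c} → Deficit (0 , c) ⇔ (lo ≤ c × c < hi)) →
    sim θ (n + d) n a b ≡ lo + (a ∸ hi) + b
  sim-topDown {lo} {hi} lo≤hi hi≤a deficit⇔ = begin
    sim θ (n + d) n a b
      ≡⟨ length-filterᵇ-++ kept (map (0 ,_) (upTo a)) (map (1 ,_) (upTo b)) ⟩
    length (filterᵇ kept (map (0 ,_) (upTo a))) + length (filterᵇ kept (map (1 ,_) (upTo b)))
      ≡⟨ cong₂ (λ xs ys → length (filterᵇ kept xs) + length (filterᵇ kept ys))
               (map-upTo _ a) (map-upTo _ b) ⟩
    length (filterᵇ kept (applyUpTo (0 ,_) a)) + length (filterᵇ kept (applyUpTo (1 ,_) b))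
      ≡⟨ cong₂ _+_ (length-filterᵇ-applyUpTo-gap deficitᵇ (0 ,_) lo≤hi hi≤a
                      (λ {c} _ → deficit⇔ {c} ⇔-∘ T-isDeficitᵇ⇔))
                   (length-filterᵇ-applyUpTo-all kept (1 ,_) b
                      (λ {c} _ → from T-not⇔¬T (no-deficit-row₁ {c} ∘ to T-isDeficitᵇ⇔))) ⟩
    lo + (a ∸ hi) + b ∎
    where
    open ≡-Reasoning
    deficitᵇ kept : Cell → Bool
    deficitᵇ = isDeficitᵇ θ (n + d) n a b
    kept = not ∘ deficitᵇ

  sim-topDown-right : a ≤ b + d → sim θ (n + d) n a b ≡ a + (a ∸ d)
  sim-topDown-right a≤b+d = begin
    sim θ (n + d) n a b         ≡⟨ sim-topDown a∸d≤b b≤a (deficit-row₀⇔-right a≤b+d) ⟩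
    a ∸ d + (a ∸ b) + b         ≡⟨ +-assoc (a ∸ d) (a ∸ b) b ⟩
    a ∸ d + (a ∸ b + b)         ≡⟨ cong (a ∸ d +_) (m∸n+n≡m b≤a) ⟩
    a ∸ d + a                   ≡⟨ +-comm (a ∸ d) a ⟩
    a + (a ∸ d)                 ∎
    where
    open ≡-Reasoning
    a∸d≤b = ≤-trans (∸-monoˡ-≤ d a≤b+d) (≤-reflexive (m+n∸n≡m b d))

  sim-topDown-left : b + d < a → sim θ (n + d) n a b ≡ b + suc d + b
  sim-topDown-left b+d<a = begin
    sim θ (n + d) n a b
      ≡⟨ sim-topDown b≤a∸1+d (m∸n≤m a (suc d)) (deficit-row₀⇔-left b+d<a) ⟩
    b + (a ∸ (a ∸ suc d)) + b
      ≡⟨ cong (λ k → b + k + b) (m∸[m∸n]≡n (≤-<-trans (m≤n+m d b) b+d<a)) ⟩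
    b + suc d + b ∎
    where
    open ≡-Reasoning
    b≤a∸1+d = m+n≤o⇒m≤o∸n b (≤-trans (≤-reflexive (+-suc b d)) b+d<a)

m+n∸o∸n≡m∸o : ∀ m n o → m + n ∸ o ∸ n ≡ m ∸ o
m+n∸o∸n≡m∸o m n o = begin
  m + n ∸ o ∸ n          ≡⟨ ∸-+-assoc (m + n) o n ⟩
  m + n ∸ (o + n)        ≡⟨ cong₂ _∸_ (+-comm m n) (+-comm o n) ⟩
  n + m ∸ (n + o)        ≡⟨ [m+n]∸[m+o]≡n∸o n m o ⟩
  m ∸ o                  ∎
  where open ≡-Reasoning

m+d+m+1∸2*j≡m∸j+1+d+m∸j : ∀ {m j} d → j ≤ m → m + d + m + 1 ∸ 2 * j ≡ (m ∸ j) + suc d + (m ∸ j)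
m+d+m+1∸2*j≡m∸j+1+d+m∸j {j = j} d j≤m with k , refl ← m≤n⇒∃[o]m+o≡n j≤m = begin
  j + k + d + (j + k) + 1 ∸ 2 * j    ≡⟨ cong (_∸ 2 * j) (regroup j k d) ⟩
  k + suc d + k + 2 * j ∸ 2 * j      ≡⟨ m+n∸n≡m (k + suc d + k) (2 * j) ⟩
  k + suc d + k                      ≡⟨ cong (λ x → x + suc d + x) (m+n∸m≡n j k) ⟨
  (j + k ∸ j) + suc d + (j + k ∸ j)  ∎
  where
  open ≡-Reasoning
  regroup : ∀ j k d → j + k + d + (j + k) + 1 ≡ k + suc d + k + 2 * j
  regroup = solve-∀

corollary5p20 : (m n i j : ℕ) → n ≤ m → Triangular m n →
    i ≤ m → j ≤ n → n ∸ j ≤ m ∸ i →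
      (j ≤ i → sim (topDown m n) m n (m ∸ i) (n ∸ j) ≡ (m ∸ i) + (0 ⊔ (n ∸ i)))
    × (i < j → sim (topDown m n) m n (m ∸ i) (n ∸ j) ≡ m + n + 1 ∸ 2 * j)
corollary5p20 m n i j n≤m _ _ j≤n b≤a with d , refl ← m≤n⇒∃[o]m+o≡n n≤m =
  let open TopDownDeficits n d (n + d ∸ i) (n ∸ j) b≤a (m∸n≤m (n + d) i) (m∸n≤m n j) in
    (λ j≤i → trans (sim-topDown-right (≤-trans (∸-monoʳ-≤ (n + d) j≤i) (≤-reflexive n+d∸j≡n∸j+d)))
                   (cong (n + d ∸ i +_) (m+n∸o∸n≡m∸o n d i)))
  , (λ i<j → trans (sim-topDown-left (≤-<-trans (≤-reflexive (sym n+d∸j≡n∸j+d))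
                                                  (∸-monoʳ-< i<j (m≤n⇒m≤n+o d j≤n))))
                   (sym (m+d+m+1∸2*j≡m∸j+1+d+m∸j d j≤n)))
  where
  n+d∸j≡n∸j+d : n + d ∸ j ≡ n ∸ j + d
  n+d∸j≡n∸j+d = +-∸-comm d j≤n
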